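{- Let $M=(S,S_0,\Delta)$ be the counter system of disjunctive process templates $A,B$. Define $\vec c\lesssim_0\vec d$ on $\mathbb N_0^{|B|}$ iff $\vec c\le\vec d$ componentwise and for all $i$: $\vec c(i)=0\Leftrightarrow\vec d(i)=0$; and define $(q_A,\vec c)\lessapprox_0(q'_A,\vec d)$ iff $q_A=q'_A$ and $\vec c\lesssim_0\vec d$. Then $(M,\lessapprox_0)$ is a well-structured transition system, i.e., $\lessapprox_0$ is a well-quasi-order on $S$ and for all $s,s',r\in S$ with $s\to s'$ and $s\lessapprox_0 r$ there is $r'$ with $s'\lessapprox_0 r'$ and $r\to^*r'$.
   Context: Let $Q_A,Q_B$ be disjoint finite sets, $Q=Q_A\cup Q_B$. A (disjunctive) process template is $U=(Q_U,\mathit{init}_U,\mathcal G_U,\delta_U)$, $U\in\{A,B\}$, with $\mathit{init}_U\in Q_U$, guards $\mathcal G_U\subseteq\mathcal P(Q)$, total transition relation $\delta_U\subseteq Q_U\times\mathcal G_U\times Q_U$. Standing assumption: $\delta_B$ contains no transition of the form $(q_i,\{q_i\},q_j)$. Write $Q_B=\{q_0,\dots,q_{|B|-1}\}$, $\vec u_i$ for unit vectors. The counter system $M=(S,S_0,\Delta)$ has $S=Q_A\times\mathbb N_0^{|B|}$, $S_0=\{(\mathit{init}_A,\vec c)\mid\vec c(q)=0\text{ for }q\ne\mathit{init}_B\}$, and $((q_A,\vec c),(q'_A,\vec c'))\in\Delta$ iff (1) $\vec c'=\vec c$ and some $(q_A,g,q'_A)\in\delta_A$ has some $q_i\in g\cap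 Q_B$ with $\vec c(i)\ge1$; or (2) $q'_A=q_A$ and some $(q_i,g,q_j)\in\delta_B$ has $\vec c(i)\ge1$, $\vec c'=\vec c-\vec u_i+\vec u_j$, and ($q_A\in g$, or some $q_l\in g\cap Q_B$, $l\ne i$, with $\vec c(l)\ge1$, or $q_i\in g$ and $\vec c(i)\ge2$). A well-quasi-order is a reflexive transitive relation such that every infinite sequence $s_0,s_1,\dots$ contains $s_i\preceq s_j$ with $i<j$; $\to^*$ denotes reachability in zero or more steps. -}

module Defs where

open import Data.Nat using (ℕ; zero; suc; _≤_; _<_; pred)
open import Data.Fin using (Fin)
open import Data.Fin.Subset using (Subset; _∈_; ⁅_⁆) renaming (⊥ to ∅)
open import Data.Vec using (Vec; lookup; _[_]%=_)
open import Data.Product using (_×_; _,_; Σ; ∃; ∃-syntax)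
open import Data.Sum using (_⊎_)
open import Relation.Nullary using (¬_)
open import Relation.Binary.PropositionalEquality using (_≡_; _≢_)
open import Relation.Binary.Structures using (IsPreorder)
open import Relation.Binary.Construct.Closure.ReflexiveTransitive using (Star)
open import Function.Bundles using (_⇔_)

-- Q_A = Fin nA, Q_B = Fin nB; Q = Q_A ⊎ Q_B (disjoint).
-- A guard g ⊆ Q is given by its A-part and its B-part.
record Guard (nA nB : ℕ) : Set where
  constructor guard
  field
    gA : Subset nA
    gB : Subset nB
open Guard public

-- A (disjunctive) process template over local states Fin n.
-- The guard set G_U is implicit: it is the set of guards occurring in δ.
record Template (n nA nB : ℕ) : Set₁ where
  field
    init  : Fin n
    δ     : Fin n → Guard nA nB → Fin n → Set
    total : ∀ q → ∃[ g ] ∃[ q' ] δ q g q'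
open Template public

NoSelfGuard : ∀ {nA nB} → Template nB nA nB → Set
NoSelfGuard {nA} {nB} B = ∀ (i j : Fin nB) → ¬ δ B i (guard ∅ ⁅ i ⁆) j

State : ℕ → ℕ → Set
State nA nB = Fin nA × Vec ℕ nB

move : ∀ {nB} → Vec ℕ nB → Fin nB → Fin nB → Vec ℕ nB
move c i j = (c [ i ]%= pred) [ j ]%= suc

Initial : ∀ {nA nB} → Template nA nA nB → Template nB nA nB → State nA nB → Set
Initial A B (qA , c) = qA ≡ init A × (∀ q → q ≢ init B → lookup c q ≡ 0)

data Step {nA nB : ℕ} (A : Template nA nA nB) (B : Template nB nA nB)
     : State nA nB → State nA nB → Set where
  stepA : ∀ {qA qA' c g} → δ A qA g qA' →
          (∃[ i ] (i ∈ gB g × 1 ≤ lookup c i)) →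
          Step A B (qA , c) (qA' , c)
  stepB : ∀ {qA c i g j} → δ B i g j → 1 ≤ lookup c i →
          (qA ∈ gA g
            ⊎ (∃[ l ] (l ≢ i × l ∈ gB g × 1 ≤ lookup c l))
            ⊎ (i ∈ gB g × 2 ≤ lookup c i)) →
          Step A B (qA , c) (qA , move c i j)

Reach : ∀ {nA nB} → Template nA nA nB → Template nB nA nB →
        State nA nB → State nA nB → Set
Reach A B = Star (Step A B)

_≲₀_ : ∀ {nB} → Vec ℕ nB → Vec ℕ nB → Set
c ≲₀ d = ∀ i → lookup c i ≤ lookup d i × (lookup c i ≡ 0 ⇔ lookup d i ≡ 0)

_⪅₀_ : ∀ {nA nB} → State nA nB → State nA nB → Set
(qA , c) ⪅₀ (qA' , d) = qA ≡ qA' × c ≲₀ d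

IsWQO : ∀ {a ℓ} {X : Set a} → (X → X → Set ℓ) → Set _
IsWQO {X = X} _≼_ =
  IsPreorder _≡_ _≼_ × (∀ (s : ℕ → X) → ∃[ i ] ∃[ j ] (i < j × s i ≼ s j))

IsWSTS : ∀ {a ℓ₁ ℓ₂} {X : Set a} → (X → X → Set ℓ₁) → (X → X → Set ℓ₂) → Set _
IsWSTS {X = X} _⟶_ _≼_ =
  IsWQO _≼_ ×
  (∀ {s s' r} → s ⟶ s' → s ≼ r → ∃[ r' ] (s' ≼ r' × Star _⟶_ r r'))

{-# OPTIONS --safe #-}
-- Almost-full relations, in the inductive sense of Vytiniotis, Coquand and
-- Wahlstedt, give a constructive route to the wqo property: equality on Q_A,
-- ≤ on ℕ and "both or neither is zero" are almost full, and almost-fullness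
-- survives inverse images and finite intersections of decidable relations,
-- so it passes to ≲₀ and ⪅₀.
-- For compatibility, A-steps, and B-steps whose source q_i holds at least two
-- processes, are replayed from the larger state in one step.  A step moving
-- the only process of q_i to q_j is matched by emptying q_i in the larger
-- state one process at a time: each of these steps is enabled by the same
-- A-state or other occupied B-state as the original one, and only adds
-- processes outside q_i.
module Submission where

open import Defs
open import Data.Nat using (ℕ; zero; suc; _≤_; _<_; _+_; _∸_; pred; z≤n; s≤s; s≤s⁻¹; _≤?_; _≟_; >-nonZero)
open import Data.Nat.Properties
  using (≤-refl; ≤-trans; ≤-reflexive; ≰⇒>; n≤0⇒n≡0; n≤1+n; pred-mono-≤; 0∸n≡0; n∸n≡0; +-suc; +-mono-≤; suc-pred)
open import Data.Nat.Induction using (<-rec)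
open import Data.Fin using (Fin; zero; suc)
import Data.Fin.Properties as Fin
open import Data.Fin.Subset using (_∈_)
open import Data.Vec using (Vec; lookup; updateAt)
open import Data.Vec.Properties using (lookup∘updateAt; lookup∘updateAt′; updateAt-updateAt; updateAt-id-local)
open import Data.Product using (_×_; _,_; proj₁; proj₂; ∃-syntax)
open import Data.Sum using (_⊎_; inj₁; inj₂)
import Data.Sum as Sum
open import Function.Base using (_on_; const; id)
open import Function.Bundles using (_⇔_; mk⇔; Equivalence)
open import Function.Construct.Composition using (_⇔-∘_)
open import Relation.Nullary using (¬_; Dec; yes; no; contradiction)
open import Relation.Nullary.Decidable using (map′; _×-dec_; _⊎-dec_; _→-dec_)
open import Relation.Unary using (Pred)
import Relation.Unary as U
open import Relation.Binary.Core using (Rel; _⇒_)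
open import Relation.Binary.Definitions using (Decidable)
open import Relation.Binary.Construct.Intersection using (_∩_)
open import Relation.Binary.Structures using (IsPreorder)
open import Relation.Binary.PropositionalEquality using (_≡_; _≢_; refl; sym; trans; cong; subst; subst₂; ≢-sym; isEquivalence)
open import Relation.Binary.Construct.Closure.ReflexiveTransitive using (ε; _◅_)
open import Level using (0ℓ)

_⇔-dec_ : ∀ {A B : Set} → Dec A → Dec B → Dec (A ⇔ B)
a? ⇔-dec b? = map′ (λ (f , g) → mk⇔ f g) (λ e → Equivalence.to e , Equivalence.from e)
                   ((a? →-dec b?) ×-dec (b? →-dec a?))

module _ {X : Set} where

  _↑_ : Rel X 0ℓ → X → Rel X 0ℓ
  (R ↑ x) y z = R y z ⊎ R x y

  data AlmostFull : Rel X 0ℓ → Set₁ where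
    full  : ∀ {R} → (∀ x y → R x y) → AlmostFull R
    later : ∀ {R} → (∀ x → AlmostFull (R ↑ x)) → AlmostFull R

  ↑-decidable : ∀ {R} → Decidable R → ∀ x → Decidable (R ↑ x)
  ↑-decidable R? x y z = R? y z ⊎-dec R? x y

  almostFull-mono : ∀ {R S} → R ⇒ S → AlmostFull R → AlmostFull S
  almostFull-mono R⇒S (full all)  = full λ x y → R⇒S (all x y)
  almostFull-mono R⇒S (later af) = later λ x → almostFull-mono (Sum.map R⇒S R⇒S) (af x)

  almostFull⇒good : ∀ {R} → AlmostFull R → (f : ℕ → X) → ∃[ i ] ∃[ j ] (i < j × R (f i) (f j))
  almostFull⇒good (full all)  f = 0 , 1 , s≤s z≤n , all (f 0) (f 1)
  almostFull⇒good (later af) f with almostFull⇒good (af (f 0)) (λ n → f (suc n))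
  ... | i , j , i<j , inj₁ r = suc i , suc j , s≤s i<j , r
  ... | i , j , i<j , inj₂ r = 0 , suc i , s≤s z≤n , r

  Select : Pred X 0ℓ → Rel X 0ℓ → Pred X 0ℓ → Rel X 0ℓ → Rel X 0ℓ
  Select P₁ U₁ P₂ U₂ y z = P₁ y × U₁ y z ⊎ P₂ y × U₂ y z

  almostFull-select : ∀ {P₁ P₂ U₁ U₂} → (∀ y → P₁ y ⊎ P₂ y) →
                      AlmostFull U₁ → AlmostFull U₂ → AlmostFull (Select P₁ U₁ P₂ U₂)
  almostFull-select {P₁} {P₂} cover af₁ af₂ = later λ x → after x (cover x) af₁ af₂
    where
    after : ∀ {U₁ U₂} x → P₁ x ⊎ P₂ x → AlmostFull U₁ → AlmostFull U₂ →
            AlmostFull (Select P₁ U₁ P₂ U₂ ↑ x)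
    after x (inj₁ p) (full all) _ = full λ y _ → inj₂ (inj₁ (p , all x y))
    after {U₁} {U₂} x (inj₁ p) (later af) af₂ = almostFull-mono shift (almostFull-select cover (af x) af₂)
      where
      shift : Select P₁ (U₁ ↑ x) P₂ U₂ ⇒ (Select P₁ U₁ P₂ U₂ ↑ x)
      shift (inj₁ (q , inj₁ u)) = inj₁ (inj₁ (q , u))
      shift (inj₁ (_ , inj₂ u)) = inj₂ (inj₁ (p , u))
      shift (inj₂ v)            = inj₁ (inj₂ v)
    after x (inj₂ p) _ (full all) = full λ y _ → inj₂ (inj₂ (p , all x y))
    after {U₁} {U₂} x (inj₂ p) af₁ (later af) = almostFull-mono shift (almostFull-select cover af₁ (af x))
      where
      shift : Select P₁ U₁ P₂ (U₂ ↑ x) ⇒ (Select P₁ U₁ P₂ U₂ ↑ x)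
      shift (inj₂ (q , inj₁ u)) = inj₁ (inj₂ (q , u))
      shift (inj₂ (_ , inj₂ u)) = inj₂ (inj₂ (p , u))
      shift (inj₁ v)            = inj₁ (inj₁ v)

  -- Once x has been seen, a later y either satisfies R x y → T x y, so that
  -- R ↑ x may replace R, or ¬ T x y, so that T ↑ x may replace T.
  almostFull-∩ : ∀ {R T} → Decidable T → AlmostFull R → AlmostFull T → AlmostFull (R ∩ T)
  almostFull-∩ T? (full all) afT = almostFull-mono (λ {x} {y} t → all x y , t) afT
  almostFull-∩ T? afR@(later _) (full all) = almostFull-mono (λ {x} {y} r → r , all x y) afR
  almostFull-∩ {R} {T} T? afR@(later afR↑) afT@(later afT↑) = later λ x →
    almostFull-mono (split x)
      (almostFull-select (cover x)
        (almostFull-∩ T? (afR↑ x) afT)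
        (almostFull-∩ (↑-decidable T? x) afR (afT↑ x)))
    where
    cover : ∀ x y → (R x y → T x y) ⊎ ¬ T x y
    cover x y with T? x y
    ... | yes t = inj₁ (const t)
    ... | no ¬t = inj₂ ¬t
    split : ∀ x → Select (λ y → R x y → T x y) ((R ↑ x) ∩ T) (λ y → ¬ T x y) (R ∩ (T ↑ x)) ⇒ ((R ∩ T) ↑ x)
    split x (inj₁ (_  , inj₁ r , t)) = inj₁ (r , t)
    split x (inj₁ (rt , inj₂ r , _)) = inj₂ (r , rt r)
    split x (inj₂ (_  , r , inj₁ t)) = inj₁ (r , t)
    split x (inj₂ (¬t , _ , inj₂ t)) = contradiction t ¬t

  almostFull-⋂ : ∀ n {R : Fin n → Rel X 0ℓ} → (∀ k → Decidable (R k)) → (∀ k → AlmostFull (R k)) →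
                 AlmostFull (λ x y → ∀ k → R k x y)
  almostFull-⋂ zero    _  _  = full λ _ _ ()
  almostFull-⋂ (suc n) {R} R? af = almostFull-mono cons
    (almostFull-∩ (λ x y → Fin.all? λ k → R? (suc k) x y)
      (af zero) (almostFull-⋂ n (λ k → R? (suc k)) (λ k → af (suc k))))
    where
    cons : ∀ {x y} → R zero x y × (∀ k → R (suc k) x y) → ∀ k → R k x y
    cons (r , rs) zero    = r
    cons (r , rs) (suc k) = rs k

  ⇔-almostFull : ∀ {P : Pred X 0ℓ} → U.Decidable P → AlmostFull (λ x y → P x ⇔ P y)
  ⇔-almostFull P? = later λ x → later λ y → full λ z _ → among (P? x) (P? y) (P? z)
    where
    both : ∀ {A B : Set} → A → B → A ⇔ B
    both a b = mk⇔ (const b) (const a)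
    neither : ∀ {A B : Set} → ¬ A → ¬ B → A ⇔ B
    neither ¬a ¬b = mk⇔ (λ a → contradiction a ¬a) (λ b → contradiction b ¬b)
    -- of three truth values two agree
    among : ∀ {A B C D : Set} → Dec A → Dec B → Dec C → (D ⊎ A ⇔ C) ⊎ (B ⇔ C ⊎ A ⇔ B)
    among (yes a) (yes b) _       = inj₂ (inj₂ (both a b))
    among (no ¬a) (no ¬b) _       = inj₂ (inj₂ (neither ¬a ¬b))
    among (yes a) (no _)  (yes c) = inj₁ (inj₂ (both a c))
    among (no ¬a) (yes _) (no ¬c) = inj₁ (inj₂ (neither ¬a ¬c))
    among (yes _) (no ¬b) (no ¬c) = inj₂ (inj₁ (neither ¬b ¬c))
    among (no _)  (yes b) (yes c) = inj₂ (inj₁ (both b c))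

almostFull-comap : ∀ {X Y : Set} {R : Rel X 0ℓ} (h : Y → X) → AlmostFull R → AlmostFull (R on h)
almostFull-comap h (full all)  = full λ a b → all (h a) (h b)
almostFull-comap h (later af) = later λ a → almostFull-comap h (af (h a))

≤-almostFull : AlmostFull _≤_
≤-almostFull = later (<-rec (λ x → AlmostFull (_≤_ ↑ x)) ≤↑-almostFull)
  where
  ≤↑-almostFull : ∀ x → (∀ {y} → y < x → AlmostFull (_≤_ ↑ y)) → AlmostFull (_≤_ ↑ x)
  ≤↑-almostFull x rec = later λ y → after y (x ≤? y)
    where
    after : ∀ y → Dec (x ≤ y) → AlmostFull ((_≤_ ↑ x) ↑ y)
    after y (yes x≤y) = full λ _ _ → inj₂ (inj₂ x≤y)
    after y (no x≰y)  = almostFull-mono (Sum.map inj₁ inj₁) (rec (≰⇒> x≰y))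

≡-almostFull : ∀ {n} → AlmostFull {Fin n} _≡_
≡-almostFull {n} = almostFull-mono (λ {x} same → sym (Equivalence.to (same x) refl))
  (almostFull-⋂ n (λ k x y → (x Fin.≟ k) ⇔-dec (y Fin.≟ k)) (λ k → ⇔-almostFull (Fin._≟ k)))

_≤₀_ : Rel ℕ 0ℓ
a ≤₀ b = a ≤ b × (a ≡ 0 ⇔ b ≡ 0)

≤₀-decidable : Decidable _≤₀_
≤₀-decidable a b = (a ≤? b) ×-dec ((a ≟ 0) ⇔-dec (b ≟ 0))

≤₀-almostFull : AlmostFull _≤₀_
≤₀-almostFull = almostFull-∩ (λ a b → (a ≟ 0) ⇔-dec (b ≟ 0)) ≤-almostFull (⇔-almostFull (_≟ 0))

≲₀-decidable : ∀ {n} → Decidable (_≲₀_ {n})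
≲₀-decidable c d = Fin.all? λ i → ≤₀-decidable (lookup c i) (lookup d i)

≲₀-almostFull : ∀ {n} → AlmostFull (_≲₀_ {n})
≲₀-almostFull {n} = almostFull-⋂ n (λ i c d → ≤₀-decidable (lookup c i) (lookup d i))
                                    (λ i → almostFull-comap (λ c → lookup c i) ≤₀-almostFull)

⪅₀-almostFull : ∀ {nA nB} → AlmostFull (_⪅₀_ {nA} {nB})
⪅₀-almostFull = almostFull-∩ (λ s t → ≲₀-decidable (proj₂ s) (proj₂ t))
  (almostFull-comap proj₁ ≡-almostFull) (almostFull-comap proj₂ ≲₀-almostFull)

≤₀-refl : ∀ {a} → a ≤₀ a
≤₀-refl = ≤-refl , mk⇔ id id

≤₀-trans : ∀ {a b c} → a ≤₀ b → b ≤₀ c → a ≤₀ c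
≤₀-trans (a≤b , a≈b) (b≤c , b≈c) = ≤-trans a≤b b≤c , b≈c ⇔-∘ a≈b

positive-≤₀ : ∀ {a b} → 1 ≤ a → a ≤ b → a ≤₀ b
positive-≤₀ {suc _} {suc _} _ a≤b = a≤b , mk⇔ (λ ()) (λ ())

⪅₀-isPreorder : ∀ {nA nB} → IsPreorder _≡_ (_⪅₀_ {nA} {nB})
⪅₀-isPreorder = record
  { isEquivalence = isEquivalence
  ; reflexive     = λ { refl → refl , λ _ → ≤₀-refl }
  ; trans         = λ (p , c≲d) (q , d≲e) → trans p q , λ i → ≤₀-trans (c≲d i) (d≲e i)
  }

module _ {n : ℕ} where

  lookup-move-other : ∀ (c : Vec ℕ n) {i j k} → k ≢ i → k ≢ j → lookup (move c i j) k ≡ lookup c k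
  lookup-move-other c {i} {j} {k} k≢i k≢j =
    trans (lookup∘updateAt′ k j k≢j (updateAt c i pred)) (lookup∘updateAt′ k i k≢i c)

  lookup-move-source : ∀ (c : Vec ℕ n) {i j} → i ≢ j → lookup (move c i j) i ≡ pred (lookup c i)
  lookup-move-source c {i} {j} i≢j =
    trans (lookup∘updateAt′ i j i≢j (updateAt c i pred)) (lookup∘updateAt i c)

  lookup-move-target : ∀ (c : Vec ℕ n) {i j} → i ≢ j → lookup (move c i j) j ≡ suc (lookup c j)
  lookup-move-target c {i} {j} i≢j =
    trans (lookup∘updateAt j (updateAt c i pred)) (cong suc (lookup∘updateAt′ j i (≢-sym i≢j) c))

  lookup-move-≥ : ∀ (c : Vec ℕ n) {i j k} → k ≢ i → lookup c k ≤ lookup (move c i j) k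
  lookup-move-≥ c {i} {j} {k} k≢i with k Fin.≟ j
  ... | yes refl = ≤-trans (n≤1+n _) (≤-reflexive (sym (lookup-move-target c (≢-sym k≢i))))
  ... | no k≢j   = ≤-reflexive (sym (lookup-move-other c k≢i k≢j))

  move-self : ∀ (c : Vec ℕ n) {i} → 1 ≤ lookup c i → move c i i ≡ c
  move-self c {i} 1≤ci =
    trans (updateAt-updateAt i c) (updateAt-id-local i c (suc-pred _ {{>-nonZero 1≤ci}}))

  moves : ℕ → Vec ℕ n → Fin n → Fin n → Vec ℕ n
  moves zero    c i j = c
  moves (suc m) c i j = moves m (move c i j) i j

  lookup-moves-other : ∀ m (c : Vec ℕ n) {i j k} → k ≢ i → k ≢ j → lookup (moves m c i j) k ≡ lookup c k
  lookup-moves-other zero    c k≢i k≢j = refl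
  lookup-moves-other (suc m) c k≢i k≢j =
    trans (lookup-moves-other m _ k≢i k≢j) (lookup-move-other c k≢i k≢j)

  lookup-moves-source : ∀ m (c : Vec ℕ n) {i j} → i ≢ j → lookup (moves m c i j) i ≡ lookup c i ∸ m
  lookup-moves-source zero    c i≢j = refl
  lookup-moves-source (suc m) c i≢j =
    trans (lookup-moves-source m _ i≢j) (trans (cong (_∸ m) (lookup-move-source c i≢j)) (pred∸ (lookup c _)))
    where
    pred∸ : ∀ a → pred a ∸ m ≡ a ∸ suc m
    pred∸ zero    = 0∸n≡0 m
    pred∸ (suc a) = refl

  lookup-moves-target : ∀ m (c : Vec ℕ n) {i j} → i ≢ j → lookup (moves m c i j) j ≡ m + lookup c j
  lookup-moves-target zero    c i≢j = refl
  lookup-moves-target (suc m) c i≢j =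
    trans (lookup-moves-target m _ i≢j) (trans (cong (m +_) (lookup-move-target c i≢j)) (+-suc m _))

  ≲₀-update : ∀ (c d c′ d′ : Vec ℕ n) i j →
              (∀ {k} → k ≢ i → k ≢ j → lookup c′ k ≡ lookup c k) →
              (∀ {k} → k ≢ i → k ≢ j → lookup d′ k ≡ lookup d k) →
              c ≲₀ d → lookup c′ i ≤₀ lookup d′ i → lookup c′ j ≤₀ lookup d′ j → c′ ≲₀ d′
  ≲₀-update _ _ _ _ i j c′≡c d′≡d c≲d ≤₀ᵢ ≤₀ⱼ k with k Fin.≟ i | k Fin.≟ j
  ... | yes refl | _        = ≤₀ᵢ
  ... | no _     | yes refl = ≤₀ⱼ
  ... | no k≢i   | no k≢j   = subst₂ _≤₀_ (sym (c′≡c k≢i k≢j)) (sym (d′≡d k≢i k≢j)) (c≲d k)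

  move-≲₀ : ∀ (c d : Vec ℕ n) {i j} → i ≢ j → 2 ≤ lookup c i → c ≲₀ d → move c i j ≲₀ move d i j
  move-≲₀ c d {i} {j} i≢j 2≤ci c≲d =
    ≲₀-update c d (move c i j) (move d i j) i j (lookup-move-other c) (lookup-move-other d) c≲d
    (subst₂ _≤₀_ (sym (lookup-move-source c i≢j)) (sym (lookup-move-source d i≢j))
      (positive-≤₀ (pred-mono-≤ 2≤ci) (pred-mono-≤ (proj₁ (c≲d i)))))
    (subst₂ _≤₀_ (sym (lookup-move-target c i≢j)) (sym (lookup-move-target d i≢j))
      (positive-≤₀ (s≤s z≤n) (s≤s (proj₁ (c≲d j)))))

  move-≲₀-moves : ∀ (c d : Vec ℕ n) {i j} → i ≢ j → 1 ≤ lookup c i → lookup c i ≤ 1 → c ≲₀ d →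
                  move c i j ≲₀ moves (lookup d i) d i j
  move-≲₀-moves c d {i} {j} i≢j 1≤ci ci≤1 c≲d =
    ≲₀-update c d (move c i j) (moves (lookup d i) d i j) i j
      (lookup-move-other c) (lookup-moves-other (lookup d i) d) c≲d
      (subst₂ _≤₀_ (sym (trans (lookup-move-source c i≢j) (n≤0⇒n≡0 (pred-mono-≤ ci≤1))))
                   (sym (trans (lookup-moves-source (lookup d i) d i≢j) (n∸n≡0 (lookup d i))))
                   ≤₀-refl)
      (subst₂ _≤₀_ (sym (lookup-move-target c i≢j)) (sym (lookup-moves-target (lookup d i) d i≢j))
        (positive-≤₀ (s≤s z≤n) (+-mono-≤ (≤-trans 1≤ci (proj₁ (c≲d i))) (proj₁ (c≲d j)))))

module Simulation {nA nB : ℕ} (A : Template nA nA nB) (B : Template nB nA nB) where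

  OtherwiseEnabled : Fin nA → Guard nA nB → Fin nB → Vec ℕ nB → Set
  OtherwiseEnabled q g i c = q ∈ gA g ⊎ ∃[ l ] (l ≢ i × l ∈ gB g × 1 ≤ lookup c l)

  Enabled : Fin nA → Guard nA nB → Fin nB → Vec ℕ nB → Set
  Enabled q g i c = OtherwiseEnabled q g i c ⊎ (i ∈ gB g × 2 ≤ lookup c i)

  otherwiseEnabled-mono : ∀ {q g i} (c d : Vec ℕ nB) → (∀ {l} → l ≢ i → lookup c l ≤ lookup d l) →
                          OtherwiseEnabled q g i c → OtherwiseEnabled q g i d
  otherwiseEnabled-mono _ _ c≤d (inj₁ q∈g)                   = inj₁ q∈g
  otherwiseEnabled-mono _ _ c≤d (inj₂ (l , l≢i , l∈g , 1≤cl)) =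
    inj₂ (l , l≢i , l∈g , ≤-trans 1≤cl (c≤d l≢i))

  enabled-mono : ∀ {q g i} (c d : Vec ℕ nB) → c ≲₀ d → Enabled q g i c → Enabled q g i d
  enabled-mono c d c≲d (inj₁ en)           = inj₁ (otherwiseEnabled-mono c d (λ {l} _ → proj₁ (c≲d l)) en)
  enabled-mono c d c≲d (inj₂ (i∈g , 2≤ci)) = inj₂ (i∈g , ≤-trans 2≤ci (proj₁ (c≲d _)))

  stepB-enabled : ∀ {q c i g j} → δ B i g j → 1 ≤ lookup c i → Enabled q g i c →
                  Step A B (q , c) (q , move c i j)
  stepB-enabled t 1≤ci en = stepB t 1≤ci (Sum.assocʳ en)

  moves-reachable : ∀ {q g i j} → δ B i g j → i ≢ j → ∀ m d → m ≤ lookup d i → OtherwiseEnabled q g i d →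
          Reach A B (q , d) (q , moves m d i j)
  moves-reachable t i≢j zero    d _      _  = ε
  moves-reachable t i≢j (suc m) d m<di en =
    stepB-enabled t (≤-trans (s≤s z≤n) m<di) (inj₁ en) ◅
    moves-reachable t i≢j m (move d _ _)
      (≤-trans (pred-mono-≤ m<di) (≤-reflexive (sym (lookup-move-source d i≢j))))
      (otherwiseEnabled-mono d (move d _ _) (lookup-move-≥ d) en)

  simulateB : ∀ {q c d i g j} → δ B i g j → 1 ≤ lookup c i → Enabled q g i c → c ≲₀ d →
              ∃[ r′ ] ((q , move c i j) ⪅₀ r′ × Reach A B (q , d) r′)
  simulateB {q} {c} {d} {i} {j = j} t 1≤ci en c≲d with i Fin.≟ j | 2 ≤? lookup c i
  ... | yes refl | _       = (q , d) , (refl , subst (_≲₀ d) (sym (move-self c 1≤ci)) c≲d) , ε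
  ... | no i≢j   | yes 2≤ci =
    (q , move d i j) , (refl , move-≲₀ c d i≢j 2≤ci c≲d) ,
    stepB-enabled t (≤-trans 1≤ci (proj₁ (c≲d i))) (enabled-mono c d c≲d en) ◅ ε
  ... | no i≢j   | no 2≰ci =
    (q , moves (lookup d i) d i j) , (refl , move-≲₀-moves c d i≢j 1≤ci (s≤s⁻¹ (≰⇒> 2≰ci)) c≲d) ,
    moves-reachable t i≢j (lookup d i) d ≤-refl
      (otherwiseEnabled-mono c d (λ {l} _ → proj₁ (c≲d l))
        (Sum.[ id , (λ (_ , 2≤ci) → contradiction 2≤ci 2≰ci) ] en))

  simulate : ∀ {s s′ r} → Step A B s s′ → s ⪅₀ r → ∃[ r′ ] (s′ ⪅₀ r′ × Reach A B r r′)
  simulate {r = q , d} (stepA t (i , i∈g , 1≤ci)) (refl , c≲d) =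
    (_ , d) , (refl , c≲d) , stepA t (i , i∈g , ≤-trans 1≤ci (proj₁ (c≲d i))) ◅ ε
  simulate (stepB {c = c} t 1≤ci en) (refl , c≲d) = simulateB {c = c} t 1≤ci (Sum.assocˡ en) c≲d

lemma3 : ∀ {nA nB : ℕ} (A : Template nA nA nB) (B : Template nB nA nB) →
           NoSelfGuard B →
           IsWSTS (Step A B) _⪅₀_
lemma3 A B _ = (⪅₀-isPreorder , almostFull⇒good ⪅₀-almostFull) , Simulation.simulate A B
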